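{- Let $n$ be a positive integer and $\delta(n)=\min\{r+s\mid r,s\in\mathbb N_0,\ r\le s,\ rs=n\}$. Then: (i) $\delta(n)<\frac n4$ if and only if both of the following hold: (a) $n\ne p,2p,3p,4p$ for every prime $p$; (b) $n\notin\{1,16,18,24,25,27,30,32,35,36,40,42,45,48,49,50,54,55,56,60,63,64,65,66,75,85,95\}$. (ii) $\delta(n)=\frac n4$ if and only if $n=64$.
   Context: $\mathbb N_0$ denotes the set of non-negative integers. -}

module Defs where

open import Data.Nat using (ℕ; zero; suc; _+_; _*_; _≤_; _⊓_; _≤ᵇ_; _≡ᵇ_)
open import Data.Bool using (Bool; true; false; _∧_; if_then_else_)
open import Data.List using (List; []; _∷_; upTo; concatMap; filter; foldr; map)
open import Data.Nat.Primality using (Prime)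
open import Relation.Binary.PropositionalEquality using (_≡_)
open import Data.Product using (_×_; _,_; ∃-syntax)

-- All sums r + s with r, s ∈ {0, …, n}, r ≤ s and r * s = n.
-- (For n ≥ 1 any such r, s automatically satisfy r, s ≤ n, so this
-- enumerates exactly the set {r + s | r,s ∈ ℕ₀, r ≤ s, r s = n}.)
candidates : ℕ → List ℕ
candidates n =
  concatMap (λ r → concatMap (λ s →
      if (r ≤ᵇ s) ∧ (r * s ≡ᵇ n) then (r + s) ∷ [] else []) (upTo (suc n)))
    (upTo (suc n))

minWith : ℕ → List ℕ → ℕ
minWith d [] = d
minWith d (x ∷ xs) = foldr _⊓_ x xs

-- δ(n) = min {r + s | r,s ∈ ℕ₀, r ≤ s, r s = n}; the set is nonempty for
-- n ≥ 1 (r = 1, s = n), so the default value is never used there.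
δ : ℕ → ℕ
δ n = minWith 0 (candidates n)

SmallMultipleOfPrime : ℕ → Set
SmallMultipleOfPrime n = ∃[ p ] ∃[ k ] (Prime p × 1 ≤ k × k ≤ 4 × n ≡ k * p)

exceptions : List ℕ
exceptions = 1 ∷ 16 ∷ 18 ∷ 24 ∷ 25 ∷ 27 ∷ 30 ∷ 32 ∷ 35 ∷ 36 ∷ 40 ∷ 42 ∷ 45 ∷ 48 ∷ 49 ∷ 50 ∷ 54 ∷ 55 ∷ 56 ∷ 60 ∷ 63 ∷ 64 ∷ 65 ∷ 66 ∷ 75 ∷ 85 ∷ 95 ∷ []

-- If n = r s, a prime p dividing n divides r or s, so r + s ≥ p + 1; for n = k p
-- with k ≤ 4 this gives 4 δ(n) > n.  Conversely, if n > 100 is not of that form,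
-- peeling off prime factors yields a factorisation n = d e with d, e ≥ 5, and
-- 4 (d + e) < d e as soon as d e > 100.  The finitely many n ≤ 100 (and the
-- exceptional values) are settled by evaluating δ.
module Submission where

open import Defs
open import Data.Nat using (ℕ; _*_; _<_; _≤_)
open import Data.Product using (_×_)
open import Data.List.Membership.Propositional using (_∈_)
open import Relation.Binary.PropositionalEquality using (_≡_)
open import Relation.Nullary using (¬_)
open import Function.Bundles using (_⇔_)

open import Data.Nat
  using (suc; _+_; _>_; _⊓_; _≤ᵇ_; _≡ᵇ_; z≤n; s≤s; z<s; s≤s⁻¹; _<?_; _≤?_; _≟_;
         NonZero; >-nonZero; >-nonZero⁻¹; n>1⇒nonTrivial)
open import Data.Nat.Properties
open import Data.Nat.Divisibility
  using (_∣_; divides; _∣?_; ∣⇒≤; ∣-trans; ∣-refl; quotient; quotient-∣; quotient-<;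
         m∣n⇒n≡quotient*m)
open import Data.Nat.Primality
  using (Prime; Composite; composite; prime?; euclidsLemma; ¬prime⇒composite)
open import Data.Nat.Induction using (<-wellFounded)
open import Data.Nat.Tactic.RingSolver using (solve-∀)
open import Data.Bool using (T; T?; true; _∧_; if_then_else_)
open import Data.Unit using (tt)
open import Data.Empty using (⊥-elim)
open import Data.Maybe using (Maybe; nothing; is-just; _<∣>_; to-witness-T)
import Data.Maybe as Maybe
open import Data.List using (List; []; _∷_; upTo; applyUpTo; concatMap)
open import Data.List.Relation.Unary.Any as Any using (here; there)
open import Data.List.Relation.Unary.All as All using (all?)
open import Data.List.Membership.Propositional using (find; lose)
open import Data.List.Membership.Propositional.Properties
  using (∈-concatMap⁻; ∈-concatMap⁺; ∈-upTo⁺; ∈-applyUpTo⁺; foldr-selective)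
open import Data.List.Membership.DecPropositional _≟_ using (_∈?_)
open import Data.List.Properties using (foldr-preservesᵒ)
open import Data.Product using (∃-syntax; _,_)
open import Data.Sum using (_⊎_; inj₁; inj₂; [_,_]′)
open import Function using (_∘_; id)
open import Function.Bundles using (mk⇔)
open import Induction.WellFounded using (Acc; acc)
open import Relation.Binary.PropositionalEquality using (refl; sym; trans; cong; subst)
open import Relation.Nullary using (yes; no)
open import Relation.Nullary.Decidable using (True; toWitness; dec⇒maybe; _⊎-dec_)
open import Relation.Unary using (Decidable)

m*n>0⇒m>0 : ∀ m {n} → m * n > 0 → m > 0
m*n>0⇒m>0 (suc m) _ = z<s

minWith-≤ : ∀ d {y xs} → y ∈ xs → minWith d xs ≤ y
minWith-≤ d {y} {x ∷ xs} y∈x∷xs = foldr-preservesᵒ ⊓-≤ x xs (≤-of y∈x∷xs)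
  where
  ⊓-≤ : ∀ a b → a ≤ y ⊎ b ≤ y → a ⊓ b ≤ y
  ⊓-≤ a b = [ m≤n⇒m⊓o≤n b , m≤n⇒o⊓m≤n a ]′
  ≤-of : y ∈ x ∷ xs → x ≤ y ⊎ Any.Any (_≤ y) xs
  ≤-of (here y≡x) = inj₁ (≤-reflexive (sym y≡x))
  ≤-of (there y∈xs) = inj₂ (Any.map (≤-reflexive ∘ sym) y∈xs)

minWith-∈ : ∀ d {y xs} → y ∈ xs → minWith d xs ∈ xs
minWith-∈ d {xs = x ∷ xs} _ with foldr-selective ⊓-sel x xs
... | inj₁ min≡x = here min≡x
... | inj₂ min∈xs = there min∈xs

pairSum : ℕ → ℕ → ℕ → List ℕ
pairSum n r s = if (r ≤ᵇ s) ∧ (r * s ≡ᵇ n) then (r + s) ∷ [] else []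

∈-pairSum⁻ : ∀ {n} r s {x} → x ∈ pairSum n r s → r * s ≡ n × x ≡ r + s
∈-pairSum⁻ {n} r s x∈ with r ≤ᵇ s | r * s ≡ᵇ n in rs≡ᵇn
∈-pairSum⁻ r s (here refl) | true | true = ≡ᵇ⇒≡ _ _ (subst T (sym rs≡ᵇn) tt) , refl

∈-pairSum⁺ : ∀ {n r s} → r ≤ s → r * s ≡ n → r + s ∈ pairSum n r s
∈-pairSum⁺ {n} {r} {s} r≤s rs≡n
  with r ≤ᵇ s | ≤⇒≤ᵇ r≤s | r * s ≡ᵇ n | ≡⇒≡ᵇ (r * s) n rs≡n
... | true | _ | true | _ = here refl

∈-candidates⁻ : ∀ {n x} → x ∈ candidates n → ∃[ r ] ∃[ s ] (r * s ≡ n × x ≡ r + s)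
∈-candidates⁻ {n} x∈
  with r , _ , x∈r ← find (∈-concatMap⁻ (λ r → concatMap (pairSum n r) (upTo (suc n)))
                                        {xs = upTo (suc n)} x∈)
  with s , _ , x∈rs ← find (∈-concatMap⁻ (pairSum n r) {xs = upTo (suc n)} x∈r)
  = r , s , ∈-pairSum⁻ r s x∈rs

∈-candidates⁺ : ∀ {n r s} → r ≤ s → s ≤ n → r * s ≡ n → r + s ∈ candidates n
∈-candidates⁺ {n} r≤s s≤n rs≡n =
  ∈-concatMap⁺ (λ r → concatMap (pairSum n r) (upTo (suc n)))
    (lose (∈-upTo⁺ (s≤s (≤-trans r≤s s≤n)))
      (∈-concatMap⁺ (pairSum n _) (lose (∈-upTo⁺ (s≤s s≤n)) (∈-pairSum⁺ r≤s rs≡n))))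

δ-minimal : ∀ {n} r s → 1 ≤ n → r * s ≡ n → δ n ≤ r + s
δ-minimal {n} r s 1≤n rs≡n = [ ordered rs≡n , swapped ]′ (≤-total r s)
  where
  ordered : ∀ {a b} → a * b ≡ n → a ≤ b → δ n ≤ a + b
  ordered {a} ab≡n a≤b =
    minWith-≤ 0 (∈-candidates⁺ a≤b (∣⇒≤ {{>-nonZero 1≤n}} (divides a (sym ab≡n))) ab≡n)
  swapped : s ≤ r → δ n ≤ r + s
  swapped s≤r = subst (δ n ≤_) (+-comm s r) (ordered (trans (*-comm s r) rs≡n) s≤r)

δ-attained : ∀ {n} → 1 ≤ n → ∃[ r ] ∃[ s ] (r * s ≡ n × δ n ≡ r + s)
δ-attained {n} 1≤n =
  ∈-candidates⁻ (minWith-∈ 0 (∈-candidates⁺ 1≤n ≤-refl (*-identityˡ n)))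

prime∣*⇒<+ : ∀ {p} r s → .{{NonZero (r * s)}} → Prime p → p ∣ r * s → p < r + s
prime∣*⇒<+ r s prime-p p∣rs with euclidsLemma r s prime-p p∣rs
... | inj₁ p∣r = ≤-<-trans (∣⇒≤ {{m*n≢0⇒m≢0 r}} p∣r) (m<m+n r (>-nonZero⁻¹ s {{m*n≢0⇒n≢0 r}}))
... | inj₂ p∣s = ≤-<-trans (∣⇒≤ {{m*n≢0⇒n≢0 r}} p∣s) (m<n+m s (>-nonZero⁻¹ r {{m*n≢0⇒m≢0 r}}))

smallMultipleOfPrime⇒n<4δ : ∀ {n} → 1 ≤ n → SmallMultipleOfPrime n → n < 4 * δ n
smallMultipleOfPrime⇒n<4δ {n} 1≤n (p , k , prime-p , _ , k≤4 , n≡kp)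
  with r , s , rs≡n , δ≡r+s ← δ-attained 1≤n = begin-strict
    n            ≡⟨ n≡kp ⟩
    k * p        ≤⟨ *-monoˡ-≤ p k≤4 ⟩
    4 * p        <⟨ *-monoʳ-< 4 (prime∣*⇒<+ r s {{nonZero-rs}} prime-p p∣rs) ⟩
    4 * (r + s)  ≡⟨ cong (4 *_) δ≡r+s ⟨
    4 * δ n      ∎
  where
  open ≤-Reasoning
  nonZero-rs = subst NonZero (sym rs≡n) (>-nonZero 1≤n)
  p∣rs = divides k (trans rs≡n n≡kp)

-- With d = 5 + a and e = 5 + b, d e + 15 = 4 (d + e) + (a + b + a b), while
-- d e ≤ 25 + 5 (a + b + a b); so d e > 100 forces a + b + a b ≥ 16.
4*[m+n]<m*n : ∀ {d e} → 5 ≤ d → 5 ≤ e → 100 < d * e → 4 * (d + e) < d * e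
4*[m+n]<m*n 5≤d 5≤e 100<de
  with a , refl ← m≤n⇒∃[o]m+o≡n 5≤d | b , refl ← m≤n⇒∃[o]m+o≡n 5≤e =
  +-cancelʳ-≤ 15 _ _ (begin
    suc (4 * (d + e)) + 15 ≡⟨ +-suc (4 * (d + e)) 15 ⟨
    4 * (d + e) + 16       ≤⟨ +-monoʳ-≤ (4 * (d + e)) 16≤c ⟩
    4 * (d + e) + c        ≡⟨ excess a b ⟨
    d * e + 15             ∎)
  where
  open ≤-Reasoning
  d = 5 + a
  e = 5 + b
  c = a + b + a * b
  excess : ∀ a b → (5 + a) * (5 + b) + 15 ≡ 4 * ((5 + a) + (5 + b)) + (a + b + a * b)
  excess = solve-∀
  bound : ∀ a b → (5 + a) * (5 + b) + 4 * (a * b) ≡ 25 + 5 * (a + b + a * b)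
  bound = solve-∀
  16≤c : 16 ≤ c
  16≤c = ≮⇒≥ λ c<16 → <⇒≱ 100<de (begin
    d * e                 ≤⟨ m≤m+n (d * e) (4 * (a * b)) ⟩
    d * e + 4 * (a * b)   ≡⟨ bound a b ⟩
    25 + 5 * c            ≤⟨ +-monoʳ-≤ 25 (*-monoʳ-≤ 5 (s≤s⁻¹ c<16)) ⟩
    100                   ∎)

TwoFactorsAtLeast : ℕ → ℕ → Set
TwoFactorsAtLeast b n = ∃[ d ] ∃[ e ] (b ≤ d × b ≤ e × d * e ≡ n)

twoFactorsAtLeast5⇒4δ<n : ∀ {n} → 100 < n → TwoFactorsAtLeast 5 n → 4 * δ n < n
twoFactorsAtLeast5⇒4δ<n {n} 100<n (d , e , 5≤d , 5≤e , de≡n) = begin-strict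
  4 * δ n      ≤⟨ *-monoʳ-≤ 4 (δ-minimal d e (≤-trans (s≤s z≤n) 100<n) de≡n) ⟩
  4 * (d + e)  <⟨ 4*[m+n]<m*n 5≤d 5≤e (subst (100 <_) (sym de≡n) 100<n) ⟩
  d * e        ≡⟨ de≡n ⟩
  n            ∎
  where open ≤-Reasoning

composite⇒divisor≥5 : ∀ {m} → 16 < m → Composite m → ∃[ d ] (5 ≤ d × d < m × d ∣ m)
composite⇒divisor≥5 {m} 16<m (composite {d} d<m d∣m) with 5 ≤? d
... | yes 5≤d = d , 5≤d , d<m , d∣m
... | no d≱5 = quotient d∣m , q≥5 , quotient-< d∣m , quotient-∣ d∣m
  where
  instance
    _ = >-nonZero (≤-trans (s≤s z≤n) 16<m)
  q≥5 : 5 ≤ quotient d∣m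
  q≥5 = ≮⇒≥ λ q<5 → <⇒≱ 16<m (begin
    m               ≡⟨ m∣n⇒n≡quotient*m d∣m ⟩
    quotient d∣m * d ≤⟨ *-mono-≤ (s≤s⁻¹ q<5) (≮⇒≥ d≱5) ⟩
    16              ∎)
    where open ≤-Reasoning

cofactor≤4⇒25<m : ∀ {t m} → t ≤ 4 → 100 < t * m → 25 < m
cofactor≤4⇒25<m t≤4 100<tm = ≮⇒≥ λ m<26 → <⇒≱ 100<tm (*-mono-≤ t≤4 (s≤s⁻¹ m<26))

-- Descend along divisors m ≥ 5 of n = t m: if t ≤ 4 then m > 25, so m is either
-- prime or has a proper divisor ≥ 5.
twoFactorsAtLeast5⊎smallMultipleOfPrime :
  ∀ {n} → 100 < n → TwoFactorsAtLeast 5 n ⊎ SmallMultipleOfPrime n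
twoFactorsAtLeast5⊎smallMultipleOfPrime {n} 100<n =
  descend n (<-wellFounded n) (≤-trans (≤ᵇ⇒≤ 5 101 tt) 100<n) ∣-refl
  where
  descend : ∀ m → Acc _<_ m → 5 ≤ m → m ∣ n → TwoFactorsAtLeast 5 n ⊎ SmallMultipleOfPrime n
  descend m (acc rec) 5≤m m∣n@(divides t n≡tm) with 5 ≤? t
  ... | yes 5≤t = inj₁ (t , m , 5≤t , 5≤m , sym n≡tm)
  ... | no t≱5 = primeOrSmaller (cofactor≤4⇒25<m t≤4 (subst (100 <_) n≡tm 100<n))
    where
    t≤4 = ≮⇒≥ t≱5
    primeOrSmaller : 25 < m → TwoFactorsAtLeast 5 n ⊎ SmallMultipleOfPrime n
    primeOrSmaller 25<m with prime? m
    ... | yes prime-m = inj₂ (m , t , prime-m , 1≤t , t≤4 , n≡tm)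
      where
      1≤t : 1 ≤ t
      1≤t = m*n>0⇒m>0 t (subst (0 <_) n≡tm (≤-trans (s≤s z≤n) 100<n))
    ... | no ¬prime-m
      with d , 5≤d , d<m , d∣m ← composite⇒divisor≥5 (≤-trans (≤ᵇ⇒≤ 17 26 tt) 25<m)
             (¬prime⇒composite {{n>1⇒nonTrivial (≤-trans (s≤s (s≤s z≤n)) 25<m)}} ¬prime-m)
      = descend d (rec d<m) 5≤d (∣-trans d∣m m∣n)

fromAll? : ∀ {P : ℕ → Set} (P? : Decidable P) xs → {True (all? P? xs)} → ∀ {x} → x ∈ xs → P x
fromAll? P? xs {all-P} = All.lookup (toWitness all-P)

exception⇒n<4δ⊎n≡64 : ∀ {n} → n ∈ exceptions → n < 4 * δ n ⊎ n ≡ 64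
exception⇒n<4δ⊎n≡64 = fromAll? (λ m → (m <? 4 * δ m) ⊎-dec (m ≟ 64)) exceptions

Excluded : ℕ → Set
Excluded n = SmallMultipleOfPrime n ⊎ n ∈ exceptions

excluded⇒n<4δ⊎n≡64 : ∀ {n} → 1 ≤ n → Excluded n → n < 4 * δ n ⊎ n ≡ 64
excluded⇒n<4δ⊎n≡64 1≤n = [ inj₁ ∘ smallMultipleOfPrime⇒n<4δ 1≤n , exception⇒n<4δ⊎n≡64 ]′

Classification : ℕ → Set
Classification n = Excluded n ⊎ 4 * δ n < n

smallMultipleOfPrime? : ∀ n → Maybe (SmallMultipleOfPrime n)
smallMultipleOfPrime? n = try 1 <∣> try 2 <∣> try 3 <∣> try 4
  where
  try : ℕ → Maybe (SmallMultipleOfPrime n)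
  try k with 1 ≤? k | k ≤? 4 | k ∣? n
  ... | yes 1≤k | yes k≤4 | yes (divides p n≡pk) =
    Maybe.map (λ prime-p → p , k , prime-p , 1≤k , k≤4 , trans n≡pk (*-comm p k))
      (dec⇒maybe (prime? p))
  ... | _ | _ | _ = nothing

classify? : ∀ n → Maybe (Classification n)
classify? n =
  Maybe.map inj₂ (dec⇒maybe (4 * δ n <? n)) <∣>
  Maybe.map (inj₁ ∘ inj₂) (dec⇒maybe (n ∈? exceptions)) <∣>
  Maybe.map (inj₁ ∘ inj₁) (smallMultipleOfPrime? n)

classify-≤100 : ∀ n → 1 ≤ n → n ≤ 100 → Classification n
classify-≤100 (suc m) _ m<100 = to-witness-T (classify? (suc m))
  (fromAll? (λ n → T? (is-just (classify? n))) (applyUpTo suc 100) (∈-applyUpTo⁺ suc m<100))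

classify : ∀ n → 1 ≤ n → Classification n
classify n 1≤n with n ≤? 100
... | yes n≤100 = classify-≤100 n 1≤n n≤100
... | no n≰100 =
  [ inj₂ ∘ twoFactorsAtLeast5⇒4δ<n 100<n , inj₁ ∘ inj₁ ]′
    (twoFactorsAtLeast5⊎smallMultipleOfPrime 100<n)
  where 100<n = ≰⇒> n≰100

proposition3p10 : (n : ℕ) → 1 ≤ n →
    ((4 * δ n < n) ⇔ ((¬ SmallMultipleOfPrime n) × (¬ (n ∈ exceptions))))
      × ((4 * δ n ≡ n) ⇔ (n ≡ 64))
proposition3p10 n 1≤n = mk⇔ below⇒ ⇒below , mk⇔ equal⇒ λ { refl → refl }
  where
  -- Both uses of refl at n = 64 evaluate δ 64 to 16.
  ¬excluded : 4 * δ n < n → ¬ Excluded n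
  ¬excluded 4δ<n excl with excluded⇒n<4δ⊎n≡64 1≤n excl
  ... | inj₁ n<4δ = <-asym 4δ<n n<4δ
  ... | inj₂ refl = <-irrefl refl 4δ<n
  below⇒ : 4 * δ n < n → ¬ SmallMultipleOfPrime n × ¬ n ∈ exceptions
  below⇒ 4δ<n = ¬excluded 4δ<n ∘ inj₁ , ¬excluded 4δ<n ∘ inj₂
  ⇒below : ¬ SmallMultipleOfPrime n × ¬ n ∈ exceptions → 4 * δ n < n
  ⇒below (¬smp , ¬exc) = [ ⊥-elim ∘ [ ¬smp , ¬exc ]′ , id ]′ (classify n 1≤n)
  equal⇒ : 4 * δ n ≡ n → n ≡ 64
  equal⇒ 4δ≡n with classify n 1≤n
  ... | inj₂ 4δ<n = ⊥-elim (<-irrefl 4δ≡n 4δ<n)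
  ... | inj₁ excl with excluded⇒n<4δ⊎n≡64 1≤n excl
  ...   | inj₁ n<4δ = ⊥-elim (<-irrefl (sym 4δ≡n) n<4δ)
  ...   | inj₂ n≡64 = n≡64
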